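{- Let $A$ be a finite set of actions partitioned as $A=A^l\uplus A^r$, with $\mathcal{P}$, $\lesssim_{cc}$, $\mathcal{L}$, $\models$ as in the context. Define $\chi:\mathcal{P}\to\mathcal{L}$ recursively by $\chi(\omega)=\top$ and, for $p\neq\omega$, \[ \chi(p)=\bigwedge_{a\in A^r,\ p\xrightarrow{a}p'}\langle a\rangle\chi(p')\ \land\ \bigwedge_{b\in A^l}[b]\Big(\bigvee_{p\xrightarrow{b}p'}\chi(p')\Big), \] where an empty conjunction is $\top$ and an empty disjunction is $\bot$. Then for every $p\in\mathcal{P}$, $\chi(p)$ is a characteristic formula for $p$, i.e. $p\models\chi(p)$ and for all $q\in\mathcal{P}$, $q\models\chi(p)$ implies $p\lesssim_{cc}q$.
   Context: Process terms over $A$ are given by $p::=0\mid\omega\mid a.p\mid p+p$ with $a\in A$; the set of process terms is $\mathcal{P}$. Their transitions are the least relation satisfying: $\omega\xrightarrow{b}\omega$ for every $b\in A^l$; $a.p\xrightarrow{a}p$ for every $a\in A$; if $p\xrightarrow{a}p'$ then $p+q\xrightarrow{a}p'$ and $q+p\xrightarrow{a}p'$. A covariant-contravariant simulation is a relation $R\subseteq\mathcal{P}\times\mathcal{P}$ such that whenever $p\,R\,q$: for all $a\in A^r$ and all $p\xrightarrow{a}p'$ there is $q\xrightarrow{a}q'$ with $p'\,R\,q'$; and for all $b\in A^l$ and all $q\xrightarrow{b}q'$ there is $p\xrightarrow{b}p'$ with $p'\,R\,q'$. Write $p\lesssim_{cc}q$ iff some covariant-contravariant simulation contains $(p,q)$.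 The logic $\mathcal{L}$ has syntax $\varphi::=\bot\mid\top\mid\varphi\land\varphi\mid\varphi\lor\varphi\mid[b]\varphi\mid\langle a\rangle\varphi$ with $a\in A^r$, $b\in A^l$; $\bot,\top,\land,\lor$ have the usual meaning, $p\models[b]\varphi$ iff $p'\models\varphi$ for all $p\xrightarrow{b}p'$, and $p\models\langle a\rangle\varphi$ iff $p'\models\varphi$ for some $p\xrightarrow{a}p'$. -}

module Defs where

open import Level using (0ℓ)
open import Data.Nat using (ℕ)
open import Data.Fin using (Fin; _≟_)
open import Data.List using (List; []; _∷_; _++_; map; allFin)
open import Data.Product using (Σ; ∃; _×_; _,_)
open import Relation.Nullary using (yes; no)

-- The finite action set A = A^l ⊎ A^r, with |A^l| = nl and |A^r| = nr.
data Act (nl nr : ℕ) : Set where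
  lft : Fin nl → Act nl nr
  rgt : Fin nr → Act nl nr

module _ {nl nr : ℕ} where

  data Proc : Set where
    𝟎   : Proc
    ω   : Proc
    _∙_ : Act nl nr → Proc → Proc
    _⊕_ : Proc → Proc → Proc

  infixr 6 _∙_
  infixl 5 _⊕_

  data Step : Proc → Act nl nr → Proc → Set where
    ω-step : ∀ b → Step ω (lft b) ω
    pre    : ∀ a p → Step (a ∙ p) a p
    sumˡ   : ∀ {p q a p'} → Step p a p' → Step (p ⊕ q) a p'
    sumʳ   : ∀ {p q a p'} → Step p a p' → Step (q ⊕ p) a p'

  IsCCSim : (Proc → Proc → Set) → Set
  IsCCSim R = ∀ p q → R p q →
      (∀ a p' → Step p (rgt a) p' → ∃ λ q' → Step q (rgt a) q' × R p' q')
    × (∀ b q' → Step q (lft b) q' → ∃ λ p' → Step p (lft b) p' × R p' q')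

  _≲cc_ : Proc → Proc → Set₁
  p ≲cc q = Σ (Proc → Proc → Set) λ R → IsCCSim R × R p q

  data Form : Set where
    ff  : Form
    tt  : Form
    _∧_ : Form → Form → Form
    _∨_ : Form → Form → Form
    [_]_ : Fin nl → Form → Form
    ⟨_⟩_ : Fin nr → Form → Form

  open import Data.Empty using (⊥)
  open import Data.Unit using (⊤)
  open import Data.Sum using (_⊎_)

  _⊨_ : Proc → Form → Set
  p ⊨ ff = ⊥
  p ⊨ tt = ⊤
  p ⊨ (φ ∧ ψ) = (p ⊨ φ) × (p ⊨ ψ)
  p ⊨ (φ ∨ ψ) = (p ⊨ φ) ⊎ (p ⊨ ψ)
  p ⊨ ([ b ] φ) = ∀ p' → Step p (lft b) p' → p' ⊨ φ
  p ⊨ (⟨ a ⟩ φ) = ∃ λ p' → Step p (rgt a) p' × p' ⊨ φ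

  ⋀ : List Form → Form
  ⋀ [] = tt
  ⋀ (φ ∷ φs) = φ ∧ ⋀ φs

  ⋁ : List Form → Form
  ⋁ [] = ff
  ⋁ (φ ∷ φs) = φ ∨ ⋁ φs

  -- helpers building the two conjuncts of χ from the list of transitions
  -- (a, χ(p')) of p  (one entry per transition p --a--> p')
  diamonds : List (Act nl nr × Form) → List Form
  diamonds [] = []
  diamonds ((lft b , φ) ∷ xs) = diamonds xs
  diamonds ((rgt a , φ) ∷ xs) = (⟨ a ⟩ φ) ∷ diamonds xs

  boxTargets : Fin nl → List (Act nl nr × Form) → List Form
  boxTargets b [] = []
  boxTargets b ((rgt a , φ) ∷ xs) = boxTargets b xs
  boxTargets b ((lft b' , φ) ∷ xs) with b ≟ b'
  ... | yes _ = φ ∷ boxTargets b xs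
  ... | no _  = boxTargets b xs

  build : List (Act nl nr × Form) → Form
  build xs = ⋀ (diamonds xs) ∧ ⋀ (map (λ b → [ b ] ⋁ (boxTargets b xs)) (allFin nl))

  mutual
    χ : Proc → Form
    χ ω = tt
    χ 𝟎 = build (trχ 𝟎)
    χ (a ∙ p) = build (trχ (a ∙ p))
    χ (p ⊕ q) = build (trχ (p ⊕ q))

    trχ : Proc → List (Act nl nr × Form)
    trχ 𝟎 = []
    trχ ω = map (λ b → (lft b , χ ω)) (allFin nl)
    trχ (a ∙ p) = (a , χ p) ∷ []
    trχ (p ⊕ q) = trχ p ++ trχ q

module Submission where

-- The proof has three layers.
--   1. trχ p enumerates exactly the transitions of p, each target paired with
--      its own characteristic formula (step-in / in-step).
--   2. For an ARBITRARY list xs of (action , formula) pairs, the formula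
--      build xs has a semantic reading (build-intro / build-elim):
--      q ⊨ build xs  iff  q matches every right pair (rgt a , φ) ∈ xs by an
--      a-step into φ, and every left step q --b--> q' lands in some φ with
--      (lft b , φ) ∈ xs.
--   3. Combining 1 and 2: every process satisfies its formula (χ-sat, by
--      induction on p), and the relation  "q ⊨ χ p"  is itself a
--      covariant-contravariant simulation (χ-isCCSim).  The theorem is the
--      pair of these facts, with that relation as the witness for p ≲cc q.

open import Defs
open import Data.Nat using (ℕ)
open import Data.Product using (∃; _×_; _,_; proj₁; proj₂)
open import Data.Sum using (inj₁; inj₂)
open import Data.Unit using (tt)
open import Data.Empty using (⊥-elim)
open import Data.Fin using (Fin; _≟_)
open import Data.List using (List; []; _∷_; map; allFin)
open import Data.List.Relation.Unary.Any using (here; there)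
open import Data.List.Membership.Propositional using (_∈_)
open import Data.List.Membership.Propositional.Properties
  using (∈-map⁺; ∈-map⁻; ∈-++⁺ˡ; ∈-++⁺ʳ; ∈-++⁻; ∈-allFin)
open import Relation.Binary.PropositionalEquality using (_≡_; refl)
open import Relation.Nullary using (yes; no)

module _ {nl nr : ℕ} where

  private
    P = Proc {nl} {nr}
    F = Form {nl} {nr}
    Label = Act nl nr × F

  ⋀-intro : ∀ {q : P} (φs : List F) → (∀ φ → φ ∈ φs → q ⊨ φ) → q ⊨ ⋀ φs
  ⋀-intro []       h = tt
  ⋀-intro (φ ∷ φs) h = h φ (here refl) , ⋀-intro φs (λ ψ m → h ψ (there m))

  ⋀-elim : ∀ {q : P} {φ} (φs : List F) → q ⊨ ⋀ φs → φ ∈ φs → q ⊨ φ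
  ⋀-elim (_ ∷ _)  (h , _) (here refl) = h
  ⋀-elim (_ ∷ φs) (_ , h) (there m)   = ⋀-elim φs h m

  ⋁-intro : ∀ {q : P} {φ} (φs : List F) → φ ∈ φs → q ⊨ φ → q ⊨ ⋁ φs
  ⋁-intro (_ ∷ _)  (here refl) h = inj₁ h
  ⋁-intro (_ ∷ φs) (there m)   h = inj₂ (⋁-intro φs m h)

  ⋁-elim : ∀ {q : P} (φs : List F) → q ⊨ ⋁ φs → ∃ λ φ → φ ∈ φs × q ⊨ φ
  ⋁-elim (φ ∷ φs) (inj₁ h) = φ , here refl , h
  ⋁-elim (φ ∷ φs) (inj₂ h) with ⋁-elim φs h
  ... | ψ , m , h' = ψ , there m , h'

  diamonds⁺ : ∀ (xs : List Label) {a φ} → (rgt a , φ) ∈ xs → (⟨ a ⟩ φ) ∈ diamonds xs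
  diamonds⁺ ((rgt a , φ) ∷ xs) (here refl) = here refl
  diamonds⁺ ((lft b , φ) ∷ xs) (there m)   = diamonds⁺ xs m
  diamonds⁺ ((rgt a , φ) ∷ xs) (there m)   = there (diamonds⁺ xs m)

  diamonds⁻ : ∀ (xs : List Label) {ψ} → ψ ∈ diamonds xs →
              ∃ λ a → ∃ λ φ → ψ ≡ (⟨ a ⟩ φ) × (rgt a , φ) ∈ xs
  diamonds⁻ ((lft b , φ) ∷ xs) m with diamonds⁻ xs m
  ... | a , φ' , e , m' = a , φ' , e , there m'
  diamonds⁻ ((rgt a , φ) ∷ xs) (here refl) = a , φ , refl , here refl
  diamonds⁻ ((rgt a , φ) ∷ xs) (there m) with diamonds⁻ xs m
  ... | a' , φ' , e , m' = a' , φ' , e , there m'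

  boxTargets⁺ : ∀ b (xs : List Label) {φ} → (lft b , φ) ∈ xs → φ ∈ boxTargets b xs
  boxTargets⁺ b ((rgt a , φ) ∷ xs) (there m) = boxTargets⁺ b xs m
  boxTargets⁺ b ((lft b' , φ) ∷ xs) m with b ≟ b'
  boxTargets⁺ b ((lft b' , φ) ∷ xs) (here refl) | yes _  = here refl
  boxTargets⁺ b ((lft b' , φ) ∷ xs) (there m)   | yes _  = there (boxTargets⁺ b xs m)
  boxTargets⁺ b ((lft b' , φ) ∷ xs) (here refl) | no b≢b = ⊥-elim (b≢b refl)
  boxTargets⁺ b ((lft b' , φ) ∷ xs) (there m)   | no _   = boxTargets⁺ b xs m

  boxTargets⁻ : ∀ b (xs : List Label) {φ} → φ ∈ boxTargets b xs → (lft b , φ) ∈ xs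
  boxTargets⁻ b ((rgt a , φ) ∷ xs) m = there (boxTargets⁻ b xs m)
  boxTargets⁻ b ((lft b' , φ) ∷ xs) m with b ≟ b'
  boxTargets⁻ b ((lft b' , φ) ∷ xs) (here refl) | yes refl = here refl
  boxTargets⁻ b ((lft b' , φ) ∷ xs) (there m)   | yes _    = there (boxTargets⁻ b xs m)
  boxTargets⁻ b ((lft b' , φ) ∷ xs) m           | no _     = there (boxTargets⁻ b xs m)

  boxClause : List Label → Fin nl → F
  boxClause xs b = [ b ] ⋁ (boxTargets b xs)

  BuildSpec : List Label → P → Set
  BuildSpec xs q =
      (∀ a φ → (rgt a , φ) ∈ xs → q ⊨ (⟨ a ⟩ φ))
    × (∀ b q' → Step q (lft b) q' → ∃ λ φ → (lft b , φ) ∈ xs × q' ⊨ φ)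

  build-intro : ∀ (xs : List Label) {q : P} → BuildSpec xs q → q ⊨ build xs
  build-intro xs {q} (forth , back) =
    ⋀-intro (diamonds xs) diamond , ⋀-intro (map (boxClause xs) (allFin nl)) box
    where
    diamond : ∀ ψ → ψ ∈ diamonds xs → q ⊨ ψ
    diamond ψ m with diamonds⁻ xs m
    ... | a , φ , refl , m' = forth a φ m'
    box-target : ∀ b q' → (∃ λ φ → (lft b , φ) ∈ xs × q' ⊨ φ) → q' ⊨ ⋁ (boxTargets b xs)
    box-target b q' (φ , m , h) = ⋁-intro (boxTargets b xs) (boxTargets⁺ b xs m) h
    box : ∀ ψ → ψ ∈ map (boxClause xs) (allFin nl) → q ⊨ ψ
    box ψ m with ∈-map⁻ (boxClause xs) m
    ... | b , _ , refl = λ q' s → box-target b q' (back b q' s)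

  build-elim : ∀ (xs : List Label) {q : P} → q ⊨ build xs → BuildSpec xs q
  build-elim xs {q} (hd , hb) = forth , back
    where
    forth : ∀ a φ → (rgt a , φ) ∈ xs → q ⊨ (⟨ a ⟩ φ)
    forth a φ m = ⋀-elim (diamonds xs) hd (diamonds⁺ xs m)
    back : ∀ b q' → Step q (lft b) q' → ∃ λ φ → (lft b , φ) ∈ xs × q' ⊨ φ
    back b q' s with ⋁-elim (boxTargets b xs)
                       (⋀-elim (map (boxClause xs) (allFin nl)) hb
                               (∈-map⁺ (boxClause xs) (∈-allFin b)) q' s)
    ... | φ , m , h = φ , boxTargets⁻ b xs m , h

  step-in : ∀ {p : P} {a p'} → Step p a p' → (a , χ p') ∈ trχ p
  step-in (ω-step b)         = ∈-map⁺ (λ b → (lft b , χ {nl} {nr} ω)) (∈-allFin b)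
  step-in (pre a p)          = here refl
  step-in (sumˡ s)           = ∈-++⁺ˡ (step-in s)
  step-in (sumʳ {q = q} s)   = ∈-++⁺ʳ (trχ q) (step-in s)

  in-step : ∀ (p : P) {a φ} → (a , φ) ∈ trχ p → ∃ λ p' → Step p a p' × φ ≡ χ p'
  in-step ω m with ∈-map⁻ (λ b → (lft b , χ {nl} {nr} ω)) m
  ... | b , _ , refl = ω , ω-step b , refl
  in-step (a ∙ p) (here refl) = p , pre a p , refl
  in-step (p ⊕ q) m with ∈-++⁻ (trχ p) m
  ... | inj₁ m' with in-step p m'
  ...   | p' , s , e = p' , sumˡ s , e
  in-step (p ⊕ q) m | inj₂ m' with in-step q m'
  ...   | p' , s , e = p' , sumʳ s , e

  -- Every process satisfies its characteristic formula.  Targets of steps are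
  -- ω or subterms of the source, which makes the mutual recursion structural.
  mutual
    χ-sat : ∀ (p : P) → p ⊨ χ p
    χ-sat ω       = tt
    χ-sat 𝟎       = build-sat 𝟎
    χ-sat (a ∙ p) = build-sat (a ∙ p)
    χ-sat (p ⊕ q) = build-sat (p ⊕ q)

    target-sat : ∀ {p : P} {a p'} → Step p a p' → p' ⊨ χ p'
    target-sat (ω-step b) = tt
    target-sat (pre a p)  = χ-sat p
    target-sat (sumˡ s)   = target-sat s
    target-sat (sumʳ s)   = target-sat s

    -- p satisfies the build of its own transitions: each right step is its own
    -- witness, and each left step is listed in trχ p.
    build-sat : ∀ (p : P) → p ⊨ build (trχ p)
    build-sat p = build-intro (trχ p) (forth , back)
      where
      forth : ∀ a φ → (rgt a , φ) ∈ trχ p → p ⊨ (⟨ a ⟩ φ)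
      forth a φ m with in-step p m
      ... | p' , s , refl = p' , s , target-sat s
      back : ∀ b p' → Step p (lft b) p' → ∃ λ φ → (lft b , φ) ∈ trχ p × p' ⊨ φ
      back b p' s = χ p' , step-in s , target-sat s

  Satisfies-χ : P → P → Set
  Satisfies-χ p q = q ⊨ χ p

  build-simulates : ∀ (p q : P) → q ⊨ build (trχ p) →
      (∀ a p' → Step p (rgt a) p' → ∃ λ q' → Step q (rgt a) q' × Satisfies-χ p' q')
    × (∀ b q' → Step q (lft b) q' → ∃ λ p' → Step p (lft b) p' × Satisfies-χ p' q')
  build-simulates p q h = forth , back
    where
    spec : BuildSpec (trχ p) q
    spec = build-elim (trχ p) h
    forth : ∀ a p' → Step p (rgt a) p' → ∃ λ q' → Step q (rgt a) q' × Satisfies-χ p' q'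
    forth a p' s = proj₁ spec a (χ p') (step-in s)
    back : ∀ b q' → Step q (lft b) q' → ∃ λ p' → Step p (lft b) p' × Satisfies-χ p' q'
    back b q' s with proj₂ spec b q' s
    ... | φ , m , h' with in-step p m
    ...   | p' , s' , refl = p' , s' , h'

  χ-isCCSim : IsCCSim Satisfies-χ
  χ-isCCSim ω       q h = (λ a p' ()) , (λ b q' s → ω , ω-step b , tt)
  χ-isCCSim 𝟎       q h = build-simulates 𝟎 q h
  χ-isCCSim (a ∙ p) q h = build-simulates (a ∙ p) q h
  χ-isCCSim (p ⊕ r) q h = build-simulates (p ⊕ r) q h

lemma8 : {nl nr : ℕ} (p : Proc {nl} {nr}) →
    (p ⊨ χ p) × (∀ q → q ⊨ χ p → p ≲cc q)
lemma8 p = χ-sat p , λ q q⊨χp → Satisfies-χ , χ-isCCSim , q⊨χp
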